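{- Let $K_n$ be the complete graph of order $n$ with edges $e_1,\dots,e_{n(n-1)/2}$, and let $H_i$ be graphs with $n_i$ vertices, $1\le i\le n(n-1)/2$. Then $$\chi_{\le 3}(K_n\diamond(H_1,\dots,H_{n(n-1)/2}))=n+\sum_{i=1}^{n(n-1)/2} n_i.$$
   Context: For a simple graph $G$ with edge set $\{e_1,\dots,e_m\}$ and simple graphs $H_1,\dots,H_m$, the generalized edge corona product $G\diamond(H_1,\dots,H_m)$ is the graph obtained by taking one (vertex-disjoint) copy of each of $G,H_1,\dots,H_m$ and joining both end vertices of the $i$-th edge $e_i$ of $G$ to every vertex of $H_i$. A $k$-distance coloring of a graph is a vertex coloring in which any two distinct vertices at distance at most $k$ receive different colors; $\chi_{\le k}$ denotes the minimum number of colors in a $k$-distance coloring. -}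

module Defs where

open import Level using (0ℓ)
open import Data.Nat using (ℕ; zero; suc; _+_; _≤_)
open import Data.Fin using (Fin) renaming (_<_ to _<ᶠ_)
open import Data.List using (map; allFin)
open import Data.Nat.ListAction using (sum)
open import Data.Product using (Σ; Σ-syntax; ∃; ∃-syntax; _×_; _,_; proj₁; proj₂)
open import Data.Sum using (_⊎_; inj₁; inj₂)
open import Relation.Binary.PropositionalEquality using (_≡_; _≢_; refl; sym)
open import Relation.Nullary using (¬_)

record Graph (V : Set) : Set₁ where
  field
    Adj    : V → V → Set
    adj-sym    : ∀ {u v} → Adj u v → Adj v u
    adj-irrefl : ∀ {u} → ¬ Adj u u
open Graph public

K : (n : ℕ) → Graph (Fin n)
K n = record { Adj = λ u v → u ≢ v ; adj-sym = λ p q → p (sym q) ; adj-irrefl = λ p → p refl }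

-- An enumeration e_1,...,e_m of the edge set of a graph G on Fin n.
record EdgeLabeling {n : ℕ} (G : Graph (Fin n)) (m : ℕ) : Set where
  field
    fst snd   : Fin m → Fin n
    ordered   : ∀ i → fst i <ᶠ snd i
    isEdge    : ∀ i → Adj G (fst i) (snd i)
    injective : ∀ i j → fst i ≡ fst j → snd i ≡ snd j → i ≡ j
    surjective : ∀ u v → u <ᶠ v → Adj G u v → ∃[ i ] (fst i ≡ u × snd i ≡ v)
open EdgeLabeling public

CoronaV : (n m : ℕ) (ns : Fin m → ℕ) → Set
CoronaV n m ns = Fin n ⊎ Σ[ i ∈ Fin m ] Fin (ns i)

module _ {n m : ℕ} (G : Graph (Fin n)) (e : EdgeLabeling G m)
         (ns : Fin m → ℕ) (H : (i : Fin m) → Graph (Fin (ns i))) where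

  IsEnd : Fin n → Fin m → Set
  IsEnd u i = (u ≡ fst e i) ⊎ (u ≡ snd e i)

  data CAdj : CoronaV n m ns → CoronaV n m ns → Set where
    gg : ∀ {u v} → Adj G u v → CAdj (inj₁ u) (inj₁ v)
    hh : ∀ {i x y} → Adj (H i) x y → CAdj (inj₂ (i , x)) (inj₂ (i , y))
    gh : ∀ {u i x} → IsEnd u i → CAdj (inj₁ u) (inj₂ (i , x))
    hg : ∀ {u i x} → IsEnd u i → CAdj (inj₂ (i , x)) (inj₁ u)

  private
    csym : ∀ {a b} → CAdj a b → CAdj b a
    csym (gg p) = gg (Graph.adj-sym G p)
    csym (hh {i} p) = hh (Graph.adj-sym (H i) p)
    csym (gh p) = hg p
    csym (hg p) = gh p

    cirr : ∀ {a} → ¬ CAdj a a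
    cirr (gg p) = Graph.adj-irrefl G p
    cirr (hh {i} p) = Graph.adj-irrefl (H i) p

  EdgeCorona : Graph (CoronaV n m ns)
  EdgeCorona = record { Adj = CAdj ; adj-sym = csym ; adj-irrefl = cirr }

data Walk {V : Set} (G : Graph V) : V → V → ℕ → Set where
  nil  : ∀ {u} → Walk G u u zero
  cons : ∀ {u v w ℓ} → Adj G u v → Walk G v w ℓ → Walk G u w (suc ℓ)

DistLe : {V : Set} (G : Graph V) → ℕ → V → V → Set
DistLe G k u v = ∃[ ℓ ] (ℓ ≤ k × Walk G u v ℓ)

IsDistColoring : {V : Set} (G : Graph V) (k c : ℕ) → (V → Fin c) → Set
IsDistColoring G k c f = ∀ u v → u ≢ v → DistLe G k u v → f u ≢ f v

HasDistColoring : {V : Set} (G : Graph V) (k c : ℕ) → Set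
HasDistColoring {V} G k c = Σ (V → Fin c) (IsDistColoring G k c)

DistChromaticNumber : {V : Set} (G : Graph V) (k c : ℕ) → Set
DistChromaticNumber G k c =
  HasDistColoring G k c × (∀ c' → HasDistColoring G k c' → c ≤ c')

sumFin : (m : ℕ) → (Fin m → ℕ) → ℕ
sumFin m ns = sum (map ns (allFin m))

module Submission where

-- The proof rests on two independent facts.
--  * Colouring: if every two vertices of a graph G are at distance ≤ k
--    (diameter at most k), a k-distance colouring must be injective, so
--    χ_{≤k}(G) is exactly the number of vertices; formally, a bijection
--    V ↔ Fin N gives χ_{≤k}(G) = N.
--  * Geometry: in K_n ⋄ (H_1,…,H_m) every vertex is within distance 1 of a
--    vertex of K_n (its "anchor": itself, or an end of the edge carrying its
--    copy of H_i), and any two vertices of K_n are within distance 1 of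
--    each other; chaining anchor → anchor gives diameter at most 3.
-- Counting: the vertex set Fin n ⊎ Σ_i Fin (n_i) is in bijection with
-- Fin (n + Σ_i n_i), by induction on the number of summands.
-- None of this uses that m = n(n-1)/2; the theorem holds for any labelling.

open import Defs
open import Data.Nat using (ℕ; _+_; _*_; _∸_; _/_; _≤_; zero; suc; s≤s; z≤n)
open import Data.Nat.Properties using (+-mono-≤)
open import Data.Nat.ListAction using (sum)
open import Data.Fin using (Fin; _≟_) renaming (zero to fzero; suc to fsuc)
open import Data.Fin.Properties using (+↔⊎; injective⇒≤)
open import Data.List.Properties using (map-tabulate)
open import Data.Product using (Σ; Σ-syntax; _,_)
open import Data.Sum using (_⊎_; inj₁; inj₂)
open import Data.Sum.Function.Propositional using (_⊎-↔_)
open import Function using (_∘_; id)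
open import Function.Bundles using (_↔_; Injection; mk↔ₛ′)
open import Function.Definitions using (Injective)
open import Function.Properties.Inverse using (↔-refl; ↔-sym; ↔-trans; ↔⇒↣)
open import Relation.Binary.Definitions using (DecidableEquality)
open import Relation.Binary.PropositionalEquality
  using (_≡_; _≢_; refl; sym; trans; cong; subst)
open import Relation.Nullary using (yes; no; contradiction; map′)

DiameterAtMost : {V : Set} → Graph V → ℕ → Set
DiameterAtMost {V} G k = (u v : V) → u ≢ v → DistLe G k u v

walk-++ : {V : Set} {G : Graph V} {u v w : V} {j k : ℕ} →
          Walk G u v j → Walk G v w k → Walk G u w (j + k)
walk-++ nil        q = q
walk-++ (cons a p) q = cons a (walk-++ p q)

distLe-trans : {V : Set} {G : Graph V} {u v w : V} {j k : ℕ} →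
               DistLe G j u v → DistLe G k v w → DistLe G (j + k) u w
distLe-trans (ℓ , ℓ≤j , p) (ℓ′ , ℓ′≤k , q) = ℓ + ℓ′ , +-mono-≤ ℓ≤j ℓ′≤k , walk-++ p q

distLe-refl : {V : Set} {G : Graph V} {k : ℕ} (u : V) → DistLe G k u u
distLe-refl u = 0 , z≤n , nil

distLe-adj : {V : Set} {G : Graph V} {u v : V} → Adj G u v → DistLe G 1 u v
distLe-adj a = 1 , s≤s z≤n , cons a nil

distColoring-injective : {V : Set} (G : Graph V) (k c : ℕ) →
  DecidableEquality V → DiameterAtMost G k →
  (col : V → Fin c) → IsDistColoring G k c col → Injective _≡_ _≡_ col
distColoring-injective G k c _≟V_ diam col proper {u} {v} same with u ≟V v
... | yes u≡v = u≡v
... | no  u≢v = contradiction same (proper u v u≢v (diam u v u≢v))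

-- A graph of diameter ≤ k on N vertices has χ_{≤k} = N: the bijection
-- itself is a colouring, and every colouring is injective.
diameter⇒distChromaticNumber : {V : Set} (G : Graph V) (k N : ℕ) →
  DiameterAtMost G k → V ↔ Fin N → DistChromaticNumber G k N
diameter⇒distChromaticNumber {V} G k N diam iso = (to , toColoring) , minimal
  where
  open Injection (↔⇒↣ iso) using (to) renaming (injective to to-injective)
  open Injection (↔⇒↣ (↔-sym iso)) using () renaming (to to from; injective to from-injective)

  toColoring : IsDistColoring G k N to
  toColoring u v u≢v _ = u≢v ∘ to-injective

  decV : DecidableEquality V
  decV u v = map′ to-injective (cong to) (to u ≟ to v)

  minimal : ∀ c → HasDistColoring G k c → N ≤ c
  minimal c (col , proper) =
    injective⇒≤ {f = col ∘ from}
      (from-injective ∘ distColoring-injective G k c decV diam col proper)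

Σ-Fin-suc↔ : {m : ℕ} (P : Fin (suc m) → Set) →
             Σ (Fin (suc m)) P ↔ (P fzero ⊎ Σ (Fin m) (P ∘ fsuc))
Σ-Fin-suc↔ P = mk↔ₛ′ split join split∘join join∘split
  where
  split : Σ _ P → P fzero ⊎ Σ _ (P ∘ fsuc)
  split (fzero  , x) = inj₁ x
  split (fsuc i , x) = inj₂ (i , x)
  join : P fzero ⊎ Σ _ (P ∘ fsuc) → Σ _ P
  join (inj₁ x)       = fzero , x
  join (inj₂ (i , x)) = fsuc i , x
  split∘join : ∀ y → split (join y) ≡ y
  split∘join (inj₁ x)       = refl
  split∘join (inj₂ (i , x)) = refl
  join∘split : ∀ p → join (split p) ≡ p
  join∘split (fzero  , x) = refl
  join∘split (fsuc i , x) = refl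

sumFin-suc : (m : ℕ) (ns : Fin (suc m) → ℕ) →
             sumFin (suc m) ns ≡ ns fzero + sumFin m (ns ∘ fsuc)
sumFin-suc m ns = cong (λ xs → ns fzero + sum xs)
  (trans (map-tabulate fsuc ns) (sym (map-tabulate id (ns ∘ fsuc))))

Σ-Fin↔sumFin : (m : ℕ) (ns : Fin m → ℕ) → (Σ[ i ∈ Fin m ] Fin (ns i)) ↔ Fin (sumFin m ns)
Σ-Fin↔sumFin zero    ns = mk↔ₛ′ (λ ()) (λ ()) (λ ()) (λ ())
Σ-Fin↔sumFin (suc m) ns =
  subst (λ s → (Σ[ i ∈ Fin (suc m) ] Fin (ns i)) ↔ Fin s) (sym (sumFin-suc m ns))
    (↔-trans (Σ-Fin-suc↔ (Fin ∘ ns))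
    (↔-trans (↔-refl ⊎-↔ Σ-Fin↔sumFin m (ns ∘ fsuc))
             (↔-sym +↔⊎)))

coronaV↔Fin : (n m : ℕ) (ns : Fin m → ℕ) → CoronaV n m ns ↔ Fin (n + sumFin m ns)
coronaV↔Fin n m ns = ↔-trans (↔-refl ⊎-↔ Σ-Fin↔sumFin m ns) (↔-sym +↔⊎)

module CompleteCorona {n m : ℕ} (e : EdgeLabeling (K n) m)
  (ns : Fin m → ℕ) (H : (i : Fin m) → Graph (Fin (ns i))) where

  C : Graph (CoronaV n m ns)
  C = EdgeCorona (K n) e ns H

  anchor : CoronaV n m ns → Fin n
  anchor (inj₁ u)       = u
  anchor (inj₂ (i , _)) = fst e i

  toAnchor : ∀ a → DistLe C 1 a (inj₁ (anchor a))
  toAnchor (inj₁ u)       = distLe-refl _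
  toAnchor (inj₂ (i , x)) = distLe-adj (hg (inj₁ refl))

  fromAnchor : ∀ a → DistLe C 1 (inj₁ (anchor a)) a
  fromAnchor (inj₁ u)       = distLe-refl _
  fromAnchor (inj₂ (i , x)) = distLe-adj (gh (inj₁ refl))

  base-distance : ∀ u v → DistLe C 1 (inj₁ u) (inj₁ v)
  base-distance u v with u ≟ v
  ... | yes refl = distLe-refl _
  ... | no  u≢v  = distLe-adj (gg u≢v)

  diameter≤3 : DiameterAtMost C 3
  diameter≤3 a b _ =
    distLe-trans (toAnchor a)
      (distLe-trans (base-distance (anchor a) (anchor b)) (fromAnchor b))

mainTheorem8 : (n : ℕ) (e : EdgeLabeling (K n) (n * (n ∸ 1) / 2))
    (ns : Fin (n * (n ∸ 1) / 2) → ℕ)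
    (H : (i : Fin (n * (n ∸ 1) / 2)) → Graph (Fin (ns i))) →
    DistChromaticNumber (EdgeCorona (K n) e ns H) 3 (n + sumFin (n * (n ∸ 1) / 2) ns)
mainTheorem8 n e ns H =
  diameter⇒distChromaticNumber _ 3 _ diameter≤3 (coronaV↔Fin n _ ns)
  where open CompleteCorona e ns H
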